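{- Let $G$ be a graph, let $\overline{G}$ be the graph obtained from $G$ by contracting every edge which is not contained in any cycle, and let $\rho:V(G)\to V(\overline{G})$ be the natural map. For $v_1,v_2\in V(G)$, $\rho(v_1)=\rho(v_2)$ if and only if $(v_1)\sim(v_2)$.
   Context: A graph is a finite connected multigraph with no loop edges. $\operatorname{Div}(G)$ is the free abelian group on $V(G)$. For $f:V(G)\to\mathbb{Z}$, $\Delta(f)=\sum_v\big(\sum_{e=vw\in E_v}(f(v)-f(w))\big)(v)$ (edges incident to $v$, with multiplicity); $D\sim D'$ iff $D-D'=\Delta(f)$ for some $f$. -}

module Defs where

open import Data.Nat using (ℕ)
open import Data.Fin using (Fin; _≟_)
open import Data.List using (List; []; _∷_; map; foldr; allFin)
open import Data.List.Membership.Propositional using (_∈_)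
open import Data.List.Relation.Unary.All using (All)
open import Data.List.Relation.Unary.Unique.Propositional using (Unique)
open import Data.Integer using (ℤ; _+_; _-_; 0ℤ; 1ℤ)
open import Data.Product using (Σ; _×_; _,_; proj₁; proj₂; ∃)
open import Data.Sum using (_⊎_)
open import Relation.Nullary using (¬_; yes; no)
open import Relation.Binary.PropositionalEquality using (_≡_; _≢_)

-- A finite multigraph without loop edges: vertices Fin n, edges Fin m,
-- edge e has endpoints ends e (an unordered pair, stored as an ordered one).
record Multigraph : Set where
  field
    n      : ℕ
    m      : ℕ
    ends   : Fin m → Fin n × Fin n
    noLoop : ∀ e → proj₁ (ends e) ≢ proj₂ (ends e)

module _ (G : Multigraph) where
  open Multigraph G

  V : Set
  V = Fin n

  E : Set
  E = Fin m

  Joins : E → V → V → Set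
  Joins e u v = ends e ≡ (u , v) ⊎ ends e ≡ (v , u)

  data Walk : V → V → Set where
    []   : ∀ {v} → Walk v v
    step : ∀ {u w v} (e : E) → Joins e u w → Walk w v → Walk u v

  walkEdges : ∀ {u v} → Walk u v → List E
  walkEdges []             = []
  walkEdges (step e _ w)   = e ∷ walkEdges w

  walkStarts : ∀ {u v} → Walk u v → List V
  walkStarts []                 = []
  walkStarts (step {u} e _ w)   = u ∷ walkStarts w

  Connected : Set
  Connected = ∀ u v → Walk u v

  record Cycle : Set where
    field
      base     : V
      walk     : Walk base base
      nonempty : walkEdges walk ≢ []
      edgesDistinct : Unique (walkEdges walk)
      vertsDistinct : Unique (walkStarts walk)

  InSomeCycle : E → Set
  InSomeCycle e = Σ Cycle λ c → e ∈ walkEdges (Cycle.walk c)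

  -- ρ(u) = ρ(v) for the natural map ρ : V(G) → V(Ḡ), where Ḡ is obtained by
  -- contracting every edge not contained in any cycle: u and v are identified
  -- iff they are joined by a walk using only such edges.
  SameImage : V → V → Set
  SameImage u v = Σ (Walk u v) λ w → All (λ e → ¬ InSomeCycle e) (walkEdges w)

  Div : Set
  Div = V → ℤ

  ⟨_⟩ : V → Div
  ⟨ v ⟩ x with x ≟ v
  ... | yes _ = 1ℤ
  ... | no  _ = 0ℤ

  _-ᴰ_ : Div → Div → Div
  (D -ᴰ D') x = D x - D' x

  edgeTerm : (V → ℤ) → V → E → ℤ
  edgeTerm f v e with ends e
  ... | (a , b) = termA + termB
    where
      termA : ℤ
      termA with v ≟ a
      ... | yes _ = f a - f b
      ... | no  _ = 0ℤ
      termB : ℤ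
      termB with v ≟ b
      ... | yes _ = f b - f a
      ... | no  _ = 0ℤ

  -- Δ(f)(v) = Σ_{e = vw ∈ E_v} (f(v) - f(w))
  Δ : (V → ℤ) → Div
  Δ f v = foldr _+_ 0ℤ (map (edgeTerm f v) (allFin m))

  _∼_ : Div → Div → Set
  D ∼ D' = ∃ λ (f : V → ℤ) → ∀ x → (D -ᴰ D') x ≡ Δ f x

-- (⇒) An edge e = ab that lies on no cycle is a bridge: the set S of vertices that reach a
-- without using e does not contain b, so e is the only edge leaving S and Δ 𝟙_S = (a) − (b).
-- Chaining these equivalences along a walk of such edges gives (u) ∼ (v).
--
-- (⇐) Let Δ f = (u) − (v) with u ≠ v and let S be the set where f attains its maximum. At a
-- vertex of S every edge term of Δ f is ≥ 0, and ≥ 1 for an edge leaving S, while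
-- Δ f ≤ (u) ≤ 1. Hence every edge leaving S starts at u and there is at most one; there is one
-- because f is not constant and G is connected. This edge e = uy is a bridge, since a cycle
-- through it would leave S a second time. Now Δ (f − 𝟙_S) = (y) − (v) and max − min has dropped
-- by one, so induction on max f − min f yields a walk from u to v through bridges.

module Submission where

open import Defs
import Algebra.Properties.CommutativeMonoid.Sum as Sum
open import Data.Bool using (if_then_else_)
open import Data.Empty using (⊥-elim)
open import Data.Fin using (Fin; zero; suc; _≟_; punchIn; punchOut)
import Data.Fin.Properties as Fin
open import Data.Integer as ℤ using (ℤ; _+_; _-_; -_; 0ℤ; 1ℤ; -1ℤ; +_; +≤+; _≤_; _<_)
open import Data.Integer.Properties hiding (_≟_)
open import Data.Integer.Tactic.RingSolver using (solve-∀)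
open import Data.List.Extrema ≤-totalOrder using (argmax; argmin; f[xs]≤f[argmax]; f[argmin]≤f[xs])
open import Data.List as List using (List; []; _∷_; _++_; length; allFin)
import Data.List.Properties as List
open import Data.List.Membership.Propositional using (_∈_; _∉_)
open import Data.List.Membership.Propositional.Properties using (∈-lookup; ∈-++⁺ʳ; ∈-allFin)
import Data.List.Membership.DecPropositional as DecMembership
open import Data.List.Relation.Binary.Subset.Propositional using (_⊆_)
open import Data.List.Relation.Binary.Subset.Propositional.Properties using (∷⁺ʳ; xs⊆x∷xs)
open import Data.List.Relation.Unary.All.Properties
  using (¬Any⇒All¬; All¬⇒¬Any; anti-mono) renaming (++⁺ to All-++⁺)
open import Data.List.Relation.Unary.All as All using (All; []; _∷_)
open import Data.List.Relation.Unary.AllPairs using ([]; _∷_)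
open import Data.List.Relation.Unary.Any using (here; there)
open import Data.List.Relation.Unary.Unique.Propositional using (Unique)
open import Data.Nat as ℕ using (ℕ; zero; suc; s≤s; z≤n)
import Data.Nat.Properties as ℕ
open import Data.Product using (Σ; ∃; _×_; _,_; proj₁; proj₂)
open import Data.Product.Properties using (≡-dec)
open import Data.Sum using (_⊎_; inj₁; inj₂)
open import Function using (_∘_; id; flip)
open import Function.Bundles using (_⇔_; mk⇔; Equivalence)
open import Relation.Nullary using (¬_; ¬?; Dec; yes; no; does)
open import Relation.Nullary.Decidable using (map′; _⊎-dec_; _×-dec_; decidable-stable)
open import Relation.Unary using (Decidable)
open import Relation.Binary.PropositionalEquality

module ∑ = Sum +-0-commutativeMonoid
open ∑ using (sum; sum-remove; sum-cong-≗; ∑-distrib-+)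

foldr-tabulate≡sum : ∀ {k} (t : Fin k → ℤ) → List.foldr _+_ 0ℤ (List.tabulate t) ≡ sum t
foldr-tabulate≡sum {zero}  t = refl
foldr-tabulate≡sum {suc k} t = cong (_+_ (t zero)) (foldr-tabulate≡sum (t ∘ suc))

sum-zero : ∀ {k} (t : Fin k → ℤ) → (∀ i → t i ≡ 0ℤ) → sum t ≡ 0ℤ
sum-zero {k} t t≡0 = trans (sum-cong-≗ t≡0) (∑.sum-replicate-zero k)

sum-single : ∀ {k} (t : Fin k → ℤ) j → (∀ i → i ≢ j → t i ≡ 0ℤ) → sum t ≡ t j
sum-single {suc k} t j t≡0 = begin
  sum t                      ≡⟨ sum-remove {i = j} t ⟩
  t j + sum (t ∘ punchIn j)  ≡⟨ cong (_+_ (t j)) (sum-zero _ (λ i → t≡0 _ (Fin.punchInᵢ≢i j i))) ⟩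
  t j + 0ℤ                   ≡⟨ +-identityʳ (t j) ⟩
  t j                        ∎
  where open ≡-Reasoning

sum-nonneg : ∀ {k} (t : Fin k → ℤ) → (∀ i → 0ℤ ≤ t i) → 0ℤ ≤ sum t
sum-nonneg {zero}  t t≥0 = ≤-refl
sum-nonneg {suc k} t t≥0 = +-mono-≤ (t≥0 zero) (sum-nonneg (t ∘ suc) (t≥0 ∘ suc))

term≤sum : ∀ {k} (t : Fin k → ℤ) → (∀ i → 0ℤ ≤ t i) → ∀ j → t j ≤ sum t
term≤sum {suc k} t t≥0 j = begin
  t j                          ≡⟨ +-identityʳ (t j) ⟨
  t j + 0ℤ                     ≤⟨ +-monoʳ-≤ (t j) (sum-nonneg _ (t≥0 ∘ punchIn j)) ⟩
  t j + sum (t ∘ punchIn j)    ≡⟨ sum-remove {i = j} t ⟨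
  sum t                        ∎
  where open ≤-Reasoning

term+term≤sum : ∀ {k} (t : Fin k → ℤ) → (∀ i → 0ℤ ≤ t i) → ∀ {i j} → i ≢ j → t i + t j ≤ sum t
term+term≤sum {suc k} t t≥0 {i} {j} i≢j = begin
  t i + t j                                   ≡⟨ cong (λ l → t i + t l) (Fin.punchIn-punchOut i≢j) ⟨
  t i + t (punchIn i (punchOut i≢j))          ≤⟨ +-monoʳ-≤ (t i) (term≤sum _ (t≥0 ∘ punchIn i) _) ⟩
  t i + sum (t ∘ punchIn i)                   ≡⟨ sum-remove {i = i} t ⟨
  sum t                                       ∎
  where open ≤-Reasoning

lookup-injective : ∀ {A : Set} {xs : List A} → Unique xs →
                   ∀ {i j} → List.lookup xs i ≡ List.lookup xs j → i ≡ j
lookup-injective (_ ∷ _)    {zero}  {zero}  _  = refl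
lookup-injective (x∉ ∷ _)   {zero}  {suc j} eq = ⊥-elim (All.lookup x∉ (∈-lookup j) eq)
lookup-injective (x∉ ∷ _)   {suc i} {zero}  eq = ⊥-elim (All.lookup x∉ (∈-lookup i) (sym eq))
lookup-injective (_ ∷ uniq) {suc i} {suc j} eq = cong suc (lookup-injective uniq eq)

Unique⇒length≤ : ∀ {n} {xs : List (Fin n)} → Unique xs → length xs ℕ.≤ n
Unique⇒length≤ uniq = Fin.injective⇒≤ (lookup-injective uniq)

unique-push : ∀ {A : Set} {x y : A} {xs} → x ∉ y ∷ xs → Unique (y ∷ xs) → Unique (y ∷ x ∷ xs)
unique-push x∉ (y∉xs ∷ xs!) = ((x∉ ∘ here ∘ sym) ∷ y∉xs) ∷ (¬Any⇒All¬ _ (x∉ ∘ there) ∷ xs!)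

unique-pop : ∀ {A : Set} {x y : A} {xs} → Unique (y ∷ x ∷ xs) → x ∉ y ∷ xs × Unique (y ∷ xs)
unique-pop {x = x} {y} {xs} ((y≢x ∷ y∉xs) ∷ (x∉xs ∷ xs!)) = x∉ , y∉xs ∷ xs!
  where
  x∉ : x ∉ y ∷ xs
  x∉ (here x≡y)  = y≢x (sym x≡y)
  x∉ (there x∈) = All¬⇒¬Any x∉xs x∈

unique-middle : ∀ {A : Set} {x : A} xs {ys} → Unique (xs ++ x ∷ ys) → All (x ≢_) xs × All (x ≢_) ys
unique-middle []       (x∉ys ∷ _)  = [] , x∉ys
unique-middle (z ∷ xs) (z∉ ∷ rest) with unique-middle xs rest
... | x∉xs , x∉ys = (λ x≡z → All.lookup z∉ (∈-++⁺ʳ xs (here refl)) (sym x≡z)) ∷ x∉xs , x∉ys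

+-minus-interchange : ∀ a b c d → (a + b) - (c + d) ≡ (a - c) + (b - d)
+-minus-interchange = solve-∀

m+n-n≡m : ∀ a b → (a + b) - b ≡ a
m+n-n≡m = solve-∀

m-n+n≡m : ∀ a b → (a - b) + b ≡ a
m-n+n≡m = solve-∀

[m-n]-[m-o]≡o-n : ∀ a b c → (a - b) - (a - c) ≡ c - b
[m-n]-[m-o]≡o-n = solve-∀

[m-1]-[n-0]≡[m-n]-1 : ∀ a b → (a - 1ℤ) - (b - 0ℤ) ≡ (a - b) - 1ℤ
[m-1]-[n-0]≡[m-n]-1 = solve-∀

i<j⇒1≤j-i : ∀ {i j} → i < j → 1ℤ ≤ j - i
i<j⇒1≤j-i {i} {j} i<j = begin
  1ℤ            ≡⟨ m+n-n≡m 1ℤ i ⟨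
  (1ℤ + i) - i  ≤⟨ +-monoˡ-≤ (- i) (i<j⇒suc[i]≤j i<j) ⟩
  j - i         ∎
  where open ≤-Reasoning

Spread : ∀ {A : Set} → (A → ℤ) → ℕ → Set
Spread f k = ∀ x y → f x - f y ≤ + k

spread-finite : ∀ {n} (f : Fin n → ℤ) → ∃ (Spread f)
spread-finite {zero}  f = 0 , λ ()
spread-finite {suc n} f = ℤ.∣ f lo - f hi ∣ , λ x y → begin
  f x - f y           ≤⟨ +-mono-≤ (hi-max x) (neg-mono-≤ (lo-min y)) ⟩
  f hi - f lo         ≡⟨ ∣-∣-≤ (lo-min hi) ⟨
  + ℤ.∣ f lo - f hi ∣ ∎
  where
  open ≤-Reasoning
  hi lo : Fin (suc n)
  hi = argmax f zero (allFin _)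
  lo = argmin f zero (allFin _)
  hi-max : ∀ x → f x ≤ f hi
  hi-max x = All.lookup (f[xs]≤f[argmax] {f = f} zero (allFin _)) (∈-allFin x)
  lo-min : ∀ x → f lo ≤ f x
  lo-min x = All.lookup (f[argmin]≤f[xs] {f = f} zero (allFin _)) (∈-allFin x)

module Laplacian (G : Multigraph) where
  open Multigraph G

  Joins-sym : ∀ {e x y} → Joins G e x y → Joins G e y x
  Joins-sym (inj₁ p) = inj₂ p
  Joins-sym (inj₂ p) = inj₁ p

  Joins-endpoints : ∀ {e x y x' y'} → Joins G e x y → Joins G e x' y' →
                    (x ≡ x' × y ≡ y') ⊎ (x ≡ y' × y ≡ x')
  Joins-endpoints (inj₁ refl) (inj₁ refl) = inj₁ (refl , refl)
  Joins-endpoints (inj₁ refl) (inj₂ refl) = inj₂ (refl , refl)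
  Joins-endpoints (inj₂ refl) (inj₁ refl) = inj₂ (refl , refl)
  Joins-endpoints (inj₂ refl) (inj₂ refl) = inj₁ (refl , refl)

  incident? : ∀ e x → Dec (∃ (Joins G e x))
  incident? e x with x ≟ proj₁ (ends e) | x ≟ proj₂ (ends e)
  ... | yes refl | _        = yes (_ , inj₁ refl)
  ... | no _     | yes refl = yes (_ , inj₂ refl)
  ... | no x≢p   | no x≢q   = no λ where
    (_ , inj₁ refl) → x≢p refl
    (_ , inj₂ refl) → x≢q refl

  edgeTerm-forward : ∀ f {e x y} → ends e ≡ (x , y) → edgeTerm G f x e ≡ f x - f y
  edgeTerm-forward f {e} {x} {y} eq with ends e | noLoop e
  ... | _ | x≢y rewrite eq with x ≟ x | x ≟ y
  ... | yes _  | no _    = +-identityʳ _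
  ... | yes _  | yes x≡y = ⊥-elim (x≢y x≡y)
  ... | no x≢x | _       = ⊥-elim (x≢x refl)

  edgeTerm-backward : ∀ f {e x y} → ends e ≡ (y , x) → edgeTerm G f x e ≡ f x - f y
  edgeTerm-backward f {e} {x} {y} eq with ends e | noLoop e
  ... | _ | y≢x rewrite eq with x ≟ y | x ≟ x
  ... | no _    | yes _  = +-identityˡ _
  ... | yes x≡y | _      = ⊥-elim (y≢x (sym x≡y))
  ... | _       | no x≢x = ⊥-elim (x≢x refl)

  edgeTerm-joins : ∀ f {e x y} → Joins G e x y → edgeTerm G f x e ≡ f x - f y
  edgeTerm-joins f (inj₁ eq) = edgeTerm-forward f eq
  edgeTerm-joins f (inj₂ eq) = edgeTerm-backward f eq

  edgeTerm-away : ∀ f {e x} → ¬ ∃ (Joins G e x) → edgeTerm G f x e ≡ 0ℤ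
  edgeTerm-away f {e} {x} away with ends e
  ... | (p , q) with x ≟ p | x ≟ q
  ... | yes refl | _        = ⊥-elim (away (q , inj₁ refl))
  ... | no _     | yes refl = ⊥-elim (away (p , inj₂ refl))
  ... | no _     | no _     = refl

  Δ≡sum : ∀ f x → Δ G f x ≡ sum (edgeTerm G f x)
  Δ≡sum f x = trans (cong (List.foldr _+_ 0ℤ) (List.map-tabulate id (edgeTerm G f x)))
                    (foldr-tabulate≡sum (edgeTerm G f x))

  edgeTerm-flat : ∀ f {e x} → (∀ {y} → Joins G e x y → f x ≡ f y) → edgeTerm G f x e ≡ 0ℤ
  edgeTerm-flat f {e} {x} flat with incident? e x
  ... | no away      = edgeTerm-away f away
  ... | yes (y , xy) = begin
    edgeTerm G f x e ≡⟨ edgeTerm-joins f xy ⟩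
    f x - f y        ≡⟨ cong (_-_ (f x)) (flat xy) ⟨
    f x - f x        ≡⟨ +-inverseʳ (f x) ⟩
    0ℤ               ∎
    where open ≡-Reasoning

  edgeTerm-cong : ∀ {f g} → (∀ x → f x ≡ g x) → ∀ x e → edgeTerm G f x e ≡ edgeTerm G g x e
  edgeTerm-cong {f} {g} f≗g x e with incident? e x
  ... | no away      = trans (edgeTerm-away f away) (sym (edgeTerm-away g away))
  ... | yes (y , xy) = begin
    edgeTerm G f x e ≡⟨ edgeTerm-joins f xy ⟩
    f x - f y        ≡⟨ cong₂ _-_ (f≗g x) (f≗g y) ⟩
    g x - g y        ≡⟨ edgeTerm-joins g xy ⟨
    edgeTerm G g x e ∎
    where open ≡-Reasoning

  edgeTerm-+ : ∀ f g x e → edgeTerm G (λ z → f z + g z) x e ≡ edgeTerm G f x e + edgeTerm G g x e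
  edgeTerm-+ f g x e with incident? e x
  ... | no away      = trans (edgeTerm-away _ away)
                                 (sym (cong₂ _+_ (edgeTerm-away f away) (edgeTerm-away g away)))
  ... | yes (y , xy) = begin
    edgeTerm G (λ z → f z + g z) x e  ≡⟨ edgeTerm-joins _ xy ⟩
    (f x + g x) - (f y + g y)         ≡⟨ +-minus-interchange (f x) (g x) (f y) (g y) ⟩
    (f x - f y) + (g x - g y)         ≡⟨ cong₂ _+_ (edgeTerm-joins f xy) (edgeTerm-joins g xy) ⟨
    edgeTerm G f x e + edgeTerm G g x e ∎
    where open ≡-Reasoning

  Δ-cong : ∀ {f g} → (∀ x → f x ≡ g x) → ∀ x → Δ G f x ≡ Δ G g x
  Δ-cong {f} {g} f≗g x = begin
    Δ G f x                ≡⟨ Δ≡sum f x ⟩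
    sum (edgeTerm G f x)   ≡⟨ sum-cong-≗ (edgeTerm-cong f≗g x) ⟩
    sum (edgeTerm G g x)   ≡⟨ Δ≡sum g x ⟨
    Δ G g x                ∎
    where open ≡-Reasoning

  Δ-+ : ∀ f g x → Δ G (λ z → f z + g z) x ≡ Δ G f x + Δ G g x
  Δ-+ f g x = begin
    Δ G (λ z → f z + g z) x                          ≡⟨ Δ≡sum _ x ⟩
    sum (edgeTerm G (λ z → f z + g z) x)             ≡⟨ sum-cong-≗ (edgeTerm-+ f g x) ⟩
    sum (λ e → edgeTerm G f x e + edgeTerm G g x e)  ≡⟨ ∑-distrib-+ (edgeTerm G f x) _ ⟩
    sum (edgeTerm G f x) + sum (edgeTerm G g x)      ≡⟨ cong₂ _+_ (Δ≡sum f x) (Δ≡sum g x) ⟨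
    Δ G f x + Δ G g x                                ∎
    where open ≡-Reasoning

  Δ-constant : ∀ f c → (∀ x → f x ≡ c) → ∀ x → Δ G f x ≡ 0ℤ
  Δ-constant f c f≡c x = trans (Δ≡sum f x) (sum-zero (edgeTerm G f x) λ e →
    edgeTerm-flat f {e} λ {y} _ → trans (f≡c x) (sym (f≡c y)))

  ⟨⟩-self : ∀ v → ⟨_⟩ G v v ≡ 1ℤ
  ⟨⟩-self v with v ≟ v
  ... | yes _  = refl
  ... | no v≢v = ⊥-elim (v≢v refl)

  ⟨⟩-other : ∀ {v x} → x ≢ v → ⟨_⟩ G v x ≡ 0ℤ
  ⟨⟩-other {v} {x} x≢v with x ≟ v
  ... | yes x≡v = ⊥-elim (x≢v x≡v)
  ... | no _    = refl

  0≤⟨⟩ : ∀ v x → 0ℤ ≤ ⟨_⟩ G v x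
  0≤⟨⟩ v x with x ≟ v
  ... | yes _ = +≤+ z≤n
  ... | no _  = +≤+ z≤n

  ⟨⟩≤1 : ∀ v x → ⟨_⟩ G v x ≤ 1ℤ
  ⟨⟩≤1 v x with x ≟ v
  ... | yes _ = ≤-refl
  ... | no _  = +≤+ z≤n

  1≤⟨⟩⇒≡ : ∀ {v x} → 1ℤ ≤ ⟨_⟩ G v x → x ≡ v
  1≤⟨⟩⇒≡ {v} {x} 1≤ with x ≟ v
  1≤⟨⟩⇒≡ 1≤       | yes x≡v = x≡v
  1≤⟨⟩⇒≡ (+≤+ ()) | no _

  ∼-refl : ∀ D → _∼_ G D D
  ∼-refl D = (λ _ → 0ℤ) , λ x → trans (+-inverseʳ (D x)) (sym (Δ-constant _ 0ℤ (λ _ → refl) x))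

  ∼-trans : ∀ {D₁ D₂ D₃} → _∼_ G D₁ D₂ → _∼_ G D₂ D₃ → _∼_ G D₁ D₃
  ∼-trans {D₁} {D₂} {D₃} (f , D₁-D₂≡Δf) (g , D₂-D₃≡Δg) = (λ x → f x + g x) , λ x → begin
    D₁ x - D₃ x                    ≡⟨ +-minus-telescope (D₁ x) (D₂ x) (D₃ x) ⟨
    (D₁ x - D₂ x) + (D₂ x - D₃ x)  ≡⟨ cong₂ _+_ (D₁-D₂≡Δf x) (D₂-D₃≡Δg x) ⟩
    Δ G f x + Δ G g x              ≡⟨ Δ-+ f g x ⟨
    Δ G (λ z → f z + g z) x        ∎
    where open ≡-Reasoning

module Walks (G : Multigraph) where
  open Multigraph G
  open Laplacian G using (Joins-sym; Joins-endpoints)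
  open DecMembership (_≟_ {n}) using (_∈?_)

  WalkWithin : (E G → Set) → V G → V G → Set
  WalkWithin P x y = Σ (Walk G x y) λ w → All P (walkEdges G w)

  IsPath : ∀ {x y} → Walk G x y → Set
  IsPath {y = y} w = Unique (y ∷ walkStarts G w)

  start∈ : ∀ {x y} (w : Walk G x y) → x ∈ y ∷ walkStarts G w
  start∈ []           = here refl
  start∈ (step _ _ _) = there (here refl)

  suffixFrom : ∀ {x z y} (w : Walk G z y) → x ∈ y ∷ walkStarts G w → IsPath w →
               Σ (Walk G x y) λ p → IsPath p × walkEdges G p ⊆ walkEdges G w
  suffixFrom w              (here refl)         _    = [] , [] ∷ [] , λ ()
  suffixFrom (step e zt w) (there (here refl)) path = step e zt w , path , id
  suffixFrom (step e zt w) (there (there x∈))  path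
    with suffixFrom w (there x∈) (proj₂ (unique-pop path))
  ... | p , p-path , p⊆w = p , p-path , there ∘ p⊆w

  shortcut : ∀ {x y} (w : Walk G x y) →
             Σ (Walk G x y) λ p → IsPath p × walkEdges G p ⊆ walkEdges G w
  shortcut []                   = [] , [] ∷ [] , id
  shortcut {x} {y} (step e xz w) with shortcut w
  ... | p , p-path , p⊆w with x ∈? y ∷ walkStarts G p
  ...   | yes x∈ = let q , q-path , q⊆p = suffixFrom p x∈ p-path in q , q-path , there ∘ p⊆w ∘ q⊆p
  ...   | no x∉  = step e xz p , unique-push x∉ p-path , λ where
                     (here refl) → here refl
                     (there e∈)  → there (p⊆w e∈)

  endpoint∈ : ∀ {x y e a b} (w : Walk G x y) → e ∈ walkEdges G w → Joins G e a b →
              a ∈ y ∷ walkStarts G w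
  endpoint∈ (step e xz w) (here refl) ab with Joins-endpoints ab xz
  ... | inj₁ (refl , _) = there (here refl)
  ... | inj₂ (refl , _) = ∷⁺ʳ _ (xs⊆x∷xs _ _) (start∈ w)
  endpoint∈ (step e xz w) (there e∈) ab = ∷⁺ʳ _ (xs⊆x∷xs _ _) (endpoint∈ w e∈ ab)

  IsPath⇒edgesUnique : ∀ {x y} (p : Walk G x y) → IsPath p → Unique (walkEdges G p)
  IsPath⇒edgesUnique []            _    = []
  IsPath⇒edgesUnique (step e xz p) path with unique-pop path
  ... | x∉ , p-path = ¬Any⇒All¬ _ (λ e∈ → x∉ (endpoint∈ p e∈ xz)) ∷ IsPath⇒edgesUnique p p-path

  _++ᵂ_ : ∀ {x y z} → Walk G x y → Walk G y z → Walk G x z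
  []           ++ᵂ q = q
  step e xz p ++ᵂ q = step e xz (p ++ᵂ q)

  walkEdges-++ : ∀ {x y z} (p : Walk G x y) (q : Walk G y z) →
                 walkEdges G (p ++ᵂ q) ≡ walkEdges G p ++ walkEdges G q
  walkEdges-++ []            q = refl
  walkEdges-++ (step e _ p) q = cong (e ∷_) (walkEdges-++ p q)

  within-++ : ∀ {P x y z} → WalkWithin P x y → WalkWithin P y z → WalkWithin P x z
  within-++ {P} (p , Pp) (q , Pq) = p ++ᵂ q , subst (All P) (sym (walkEdges-++ p q)) (All-++⁺ Pp Pq)

  within-reverse : ∀ {P x y} (w : Walk G x y) → All P (walkEdges G w) → WalkWithin P y x
  within-reverse []             []        = [] , []
  within-reverse (step e xz w) (Pe ∷ Pw) =
    within-++ (within-reverse w Pw) (step e (Joins-sym xz) [] , Pe ∷ [])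

  splitAt : ∀ {x y e} (w : Walk G x y) → e ∈ walkEdges G w →
            Σ (V G) λ s → Σ (V G) λ t → Joins G e s t × Σ (Walk G x s) λ p → Σ (Walk G t y) λ q →
            walkEdges G w ≡ walkEdges G p ++ e ∷ walkEdges G q
  splitAt (step e st w)  (here refl) = _ , _ , st , [] , w , refl
  splitAt (step e' xz w) (there e∈) with splitAt w e∈
  ... | s , t , st , p , q , edges≡ = s , t , st , step e' xz p , q , cong (e' ∷_) edges≡

  inSomeCycle⇔detour : ∀ {e a b} → Joins G e a b → InSomeCycle G e ⇔ WalkWithin (e ≢_) b a
  inSomeCycle⇔detour {e} {a} {b} ab = mk⇔ detour cycle
    where
    detour : InSomeCycle G e → WalkWithin (e ≢_) b a
    detour (c , e∈) with splitAt (Cycle.walk c) e∈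
    ... | s , t , st , p , q , edges≡
        with unique-middle (walkEdges G p) (subst Unique edges≡ (Cycle.edgesDistinct c))
    ...   | e∉p , e∉q with Joins-endpoints st ab | within-++ (q , e∉q) (p , e∉p)
    ...     | inj₁ (refl , refl) | around = around
    ...     | inj₂ (refl , refl) | around = within-reverse (proj₁ around) (proj₂ around)
    cycle : WalkWithin (e ≢_) b a → InSomeCycle G e
    cycle (w , e∉w) with shortcut w
    ... | p , p-path , p⊆w = record
      { base          = a
      ; walk          = step e ab p
      ; nonempty      = λ ()
      ; edgesDistinct = anti-mono p⊆w e∉w ∷ IsPath⇒edgesUnique p p-path
      ; vertsDistinct = p-path
      } , here refl

  Leaves : (V G → Set) → E G → V G → V G → Set
  Leaves P e x y = Joins G e x y × P x × ¬ P y

  walk-exits : ∀ {P} → Decidable P → ∀ {x y} (w : Walk G x y) → P x → ¬ P y →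
               Σ (E G) λ e → e ∈ walkEdges G w × Σ (V G) λ x' → Σ (V G) λ y' → Leaves P e x' y'
  walk-exits P? []                     Px ¬Py = ⊥-elim (¬Py Px)
  walk-exits P? (step {w = z} e xz w) Px ¬Py with P? z
  ... | no ¬Pz = e , here refl , _ , _ , xz , Px , ¬Pz
  ... | yes Pz with walk-exits P? w Pz ¬Py
  ...   | e' , e'∈ , leaving = e' , there e'∈ , leaving

module Reachability (G : Multigraph) where
  open Multigraph G
  open Walks G

  Joins? : ∀ e x y → Dec (Joins G e x y)
  Joins? e x y = ≡-dec _≟_ _≟_ (ends e) (x , y) ⊎-dec ≡-dec _≟_ _≟_ (ends e) (y , x)

  module _ {P : E G → Set} (P? : Decidable P) (y : V G) where
    ReachesWithin : ℕ → V G → Set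
    ReachesWithin zero    x = x ≡ y
    ReachesWithin (suc k) x = x ≡ y ⊎ ∃ λ e → P e × ∃ λ z → Joins G e x z × ReachesWithin k z

    reachesWithin? : ∀ k x → Dec (ReachesWithin k x)
    reachesWithin? zero    x = x ≟ y
    reachesWithin? (suc k) x =
      x ≟ y ⊎-dec Fin.any? λ e → P? e ×-dec Fin.any? λ z → Joins? e x z ×-dec reachesWithin? k z

    reachesWithin⇒walk : ∀ k {x} → ReachesWithin k x → WalkWithin P x y
    reachesWithin⇒walk zero    refl        = [] , []
    reachesWithin⇒walk (suc k) (inj₁ refl) = [] , []
    reachesWithin⇒walk (suc k) (inj₂ (e , Pe , _ , xz , reaches)) with reachesWithin⇒walk k reaches
    ... | w , Pw = step e xz w , Pe ∷ Pw

    walk⇒reachesWithin : ∀ k {x} (w : Walk G x y) → All P (walkEdges G w) →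
                         length (walkStarts G w) ℕ.≤ k → ReachesWithin k x
    walk⇒reachesWithin zero    []             _         _         = refl
    walk⇒reachesWithin (suc k) []             _         _         = inj₁ refl
    walk⇒reachesWithin (suc k) (step e xz w) (Pe ∷ Pw) (s≤s len) =
      inj₂ (e , Pe , _ , xz , walk⇒reachesWithin k w Pw len)

  -- Bounded search suffices: by `shortcut` a walk can be replaced by a path, which has < n steps.
  walkWithin? : ∀ {P} → Decidable P → ∀ x y → Dec (WalkWithin P x y)
  walkWithin? P? x y = map′ (reachesWithin⇒walk P? y n) reaches (reachesWithin? P? y n x)
    where
    reaches : WalkWithin _ x y → ReachesWithin P? y n x
    reaches (w , Pw) with shortcut w
    ... | p , p-path , p⊆w =
      walk⇒reachesWithin P? y n p (anti-mono p⊆w Pw) (ℕ.<⇒≤ (Unique⇒length≤ p-path))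

module Cuts (G : Multigraph) where
  open Laplacian G
  open Walks G
  open Reachability G

  𝟙 : ∀ {P : V G → Set} → Decidable P → V G → ℤ
  𝟙 P? x = if does (P? x) then 1ℤ else 0ℤ

  𝟙-yes : ∀ {P} (P? : Decidable P) {x} → P x → 𝟙 P? x ≡ 1ℤ
  𝟙-yes P? {x} Px with P? x
  ... | yes _  = refl
  ... | no ¬Px = ⊥-elim (¬Px Px)

  𝟙-no : ∀ {P} (P? : Decidable P) {x} → ¬ P x → 𝟙 P? x ≡ 0ℤ
  𝟙-no P? {x} ¬Px with P? x
  ... | yes Px = ⊥-elim (¬Px Px)
  ... | no _   = refl

  OnlyExit : (V G → Set) → E G → Set
  OnlyExit P e = ∀ {e' x y} → Leaves P e' x y → e' ≡ e

  Δ-𝟙 : ∀ {P} (P? : Decidable P) {e a b} → Leaves P e a b → OnlyExit P e →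
        ∀ x → Δ G (𝟙 P?) x ≡ ⟨_⟩ G a x - ⟨_⟩ G b x
  Δ-𝟙 {P} P? {e} {a} {b} (ab , Pa , ¬Pb) only x = begin
    Δ G (𝟙 P?) x               ≡⟨ Δ≡sum (𝟙 P?) x ⟩
    sum (edgeTerm G (𝟙 P?) x)  ≡⟨ sum-single _ e others-vanish ⟩
    edgeTerm G (𝟙 P?) x e      ≡⟨ term-at-e (x ≟ a) (x ≟ b) ⟩
    ⟨_⟩ G a x - ⟨_⟩ G b x      ∎
    where
    open ≡-Reasoning
    a≢b : a ≢ b
    a≢b refl = ¬Pb Pa
    flat : ∀ {e' x y} → e' ≢ e → Joins G e' x y → 𝟙 P? x ≡ 𝟙 P? y
    flat {x = x} {y} e'≢e xy with P? x | P? y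
    ... | yes _  | yes _  = refl
    ... | no _   | no _   = refl
    ... | yes Px | no ¬Py = ⊥-elim (e'≢e (only (xy , Px , ¬Py)))
    ... | no ¬Px | yes Py = ⊥-elim (e'≢e (only (Joins-sym xy , Py , ¬Px)))
    others-vanish : ∀ e' → e' ≢ e → edgeTerm G (𝟙 P?) x e' ≡ 0ℤ
    others-vanish e' e'≢e = edgeTerm-flat (𝟙 P?) {e'} {x} (flat e'≢e)
    term-at-e : Dec (x ≡ a) → Dec (x ≡ b) → edgeTerm G (𝟙 P?) x e ≡ ⟨_⟩ G a x - ⟨_⟩ G b x
    term-at-e (yes refl) _ = begin
      edgeTerm G (𝟙 P?) a e   ≡⟨ edgeTerm-joins (𝟙 P?) ab ⟩
      𝟙 P? a - 𝟙 P? b         ≡⟨ cong₂ _-_ (𝟙-yes P? Pa) (𝟙-no P? ¬Pb) ⟩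
      1ℤ - 0ℤ                 ≡⟨ cong₂ _-_ (⟨⟩-self a) (⟨⟩-other a≢b) ⟨
      ⟨_⟩ G a a - ⟨_⟩ G b a   ∎
    term-at-e (no x≢a) (yes refl) = begin
      edgeTerm G (𝟙 P?) b e   ≡⟨ edgeTerm-joins (𝟙 P?) (Joins-sym ab) ⟩
      𝟙 P? b - 𝟙 P? a         ≡⟨ cong₂ _-_ (𝟙-no P? ¬Pb) (𝟙-yes P? Pa) ⟩
      0ℤ - 1ℤ                 ≡⟨ cong₂ _-_ (⟨⟩-other x≢a) (⟨⟩-self b) ⟨
      ⟨_⟩ G a b - ⟨_⟩ G b b   ∎
    term-at-e (no x≢a) (no x≢b) = begin
      edgeTerm G (𝟙 P?) x e   ≡⟨ edgeTerm-away (𝟙 P?) not-endpoint ⟩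
      0ℤ - 0ℤ                 ≡⟨ cong₂ _-_ (⟨⟩-other x≢a) (⟨⟩-other x≢b) ⟨
      ⟨_⟩ G a x - ⟨_⟩ G b x   ∎
      where
      not-endpoint : ¬ ∃ (Joins G e x)
      not-endpoint (_ , xy) with Joins-endpoints xy ab
      ... | inj₁ (x≡a , _) = x≢a x≡a
      ... | inj₂ (x≡b , _) = x≢b x≡b

  onlyExit⇒notInCycle : ∀ {P} → Decidable P → ∀ {e a b} → Leaves P e a b → OnlyExit P e →
                        ¬ InSomeCycle G e
  onlyExit⇒notInCycle P? (ab , Pa , ¬Pb) only e-cycle
    with Equivalence.to (inSomeCycle⇔detour (Joins-sym ab)) e-cycle
  ... | w , e∉w with walk-exits P? w Pa ¬Pb
  ...   | e' , e'∈w , _ , _ , leaves = All.lookup e∉w e'∈w (sym (only leaves))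

  bridge-∼ : ∀ {e a b} → ¬ InSomeCycle G e → Joins G e a b → _∼_ G (⟨_⟩ G a) (⟨_⟩ G b)
  bridge-∼ {e} {a} {b} e-acyclic ab = 𝟙 reaches-a? , λ x → sym (Δ-𝟙 reaches-a? leaves only x)
    where
    ReachesA : V G → Set
    ReachesA x = WalkWithin (e ≢_) x a
    reaches-a? : Decidable ReachesA
    reaches-a? x = walkWithin? (λ e' → ¬? (e ≟ e')) x a
    leaves : Leaves ReachesA e a b
    leaves = ab , ([] , []) , e-acyclic ∘ Equivalence.from (inSomeCycle⇔detour ab)
    only : OnlyExit ReachesA e
    only {e'} (xy , (w , e∉w) , ¬y-reaches) with e' ≟ e
    ... | yes e'≡e = e'≡e
    ... | no e'≢e  = ⊥-elim (¬y-reaches (step e' (Joins-sym xy) w , (e'≢e ∘ sym) ∷ e∉w))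

  sameImage⇒∼ : ∀ {u v} → SameImage G u v → _∼_ G (⟨_⟩ G u) (⟨_⟩ G v)
  sameImage⇒∼ {u} ([] , [])                     = ∼-refl (⟨_⟩ G u)
  sameImage⇒∼ {u} {v} (step {w = z} e uz w , e-acyclic ∷ rest) =
    ∼-trans {⟨_⟩ G u} {⟨_⟩ G z} {⟨_⟩ G v} (bridge-∼ e-acyclic uz) (sameImage⇒∼ (w , rest))

module MaximumLevelSet (G : Multigraph) (f : V G → ℤ) {u v : V G}
                       (Δf : ∀ x → ⟨_⟩ G u x - ⟨_⟩ G v x ≡ Δ G f x) where
  open Multigraph G
  open Laplacian G
  open Walks G
  open Cuts G

  top : V G
  top = argmax f u (allFin n)

  top-max : ∀ x → f x ≤ f top
  top-max x = All.lookup (f[xs]≤f[argmax] u (allFin n)) (∈-allFin x)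

  Top : V G → Set
  Top x = f x ≡ f top

  top? : Decidable Top
  top? x = f x ℤ.≟ f top

  Δf≤⟨u⟩ : ∀ x → Δ G f x ≤ ⟨_⟩ G u x
  Δf≤⟨u⟩ x = begin
    Δ G f x                    ≡⟨ Δf x ⟨
    ⟨_⟩ G u x - ⟨_⟩ G v x      ≤⟨ +-monoʳ-≤ (⟨_⟩ G u x) (neg-mono-≤ (0≤⟨⟩ v x)) ⟩
    ⟨_⟩ G u x + 0ℤ             ≡⟨ +-identityʳ _ ⟩
    ⟨_⟩ G u x                  ∎
    where open ≤-Reasoning

  edgeTerm-nonneg : ∀ {x} → Top x → ∀ e → 0ℤ ≤ edgeTerm G f x e
  edgeTerm-nonneg {x} x-top e with incident? e x
  ... | no away      = ≤-reflexive (sym (edgeTerm-away f away))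
  ... | yes (y , xy) = subst (0ℤ ≤_) (sym (edgeTerm-joins f xy))
                             (i≤j⇒0≤j-i (subst (f y ≤_) (sym x-top) (top-max y)))

  edgeTerm-exit : ∀ {e x y} → Leaves Top e x y → 1ℤ ≤ edgeTerm G f x e
  edgeTerm-exit {e} {x} {y} (xy , x-top , ¬y-top) =
    subst (1ℤ ≤_) (sym (edgeTerm-joins f xy)) (i<j⇒1≤j-i (≤∧≢⇒< fy≤fx (¬y-top ∘ flip trans x-top)))
    where
    fy≤fx : f y ≤ f x
    fy≤fx = subst (f y ≤_) (sym x-top) (top-max y)

  exit-term≤⟨u⟩ : ∀ {e x y} → Leaves Top e x y → edgeTerm G f x e ≤ ⟨_⟩ G u x
  exit-term≤⟨u⟩ {e} {x} (_ , x-top , _) = begin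
    edgeTerm G f x e      ≤⟨ term≤sum _ (edgeTerm-nonneg x-top) e ⟩
    sum (edgeTerm G f x)  ≡⟨ Δ≡sum f x ⟨
    Δ G f x               ≤⟨ Δf≤⟨u⟩ x ⟩
    ⟨_⟩ G u x             ∎
    where open ≤-Reasoning

  exit-from-u : ∀ {e x y} → Leaves Top e x y → x ≡ u
  exit-from-u leaving = 1≤⟨⟩⇒≡ (≤-trans (edgeTerm-exit leaving) (exit-term≤⟨u⟩ leaving))

  exit-unique : ∀ {e x y} → Leaves Top e x y → OnlyExit Top e
  exit-unique {e} leaving {e'} leaving' with exit-from-u leaving | exit-from-u leaving' | e' ≟ e
  ... | refl | refl | yes e'≡e = e'≡e
  ... | refl | refl | no e'≢e  = ⊥-elim (2≰1 (begin
    1ℤ + 1ℤ           ≤⟨ +-mono-≤ (edgeTerm-exit leaving') (edgeTerm-exit leaving) ⟩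
    term e' + term e  ≤⟨ term+term≤sum term (edgeTerm-nonneg u-top) e'≢e ⟩
    sum term          ≡⟨ Δ≡sum f u ⟨
    Δ G f u           ≤⟨ Δf≤⟨u⟩ u ⟩
    ⟨_⟩ G u u         ≤⟨ ⟨⟩≤1 u u ⟩
    1ℤ                ∎))
    where
    open ≤-Reasoning
    2≰1 : ¬ (1ℤ + 1ℤ ≤ 1ℤ)
    2≰1 (+≤+ (s≤s ()))
    term : E G → ℤ
    term = edgeTerm G f u
    u-top : Top u
    u-top = proj₁ (proj₂ leaving)

  lowered : V G → ℤ
  lowered x = f x - 𝟙 top? x

  Δ-lowered : ∀ {e y} → Leaves Top e u y → OnlyExit Top e →
              ∀ x → ⟨_⟩ G y x - ⟨_⟩ G v x ≡ Δ G lowered x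
  Δ-lowered {y = y} leaving only x = begin
    ⟨_⟩ G y x - ⟨_⟩ G v x                               ≡⟨ [m-n]-[m-o]≡o-n (⟨_⟩ G u x) _ _ ⟨
    (⟨_⟩ G u x - ⟨_⟩ G v x) - (⟨_⟩ G u x - ⟨_⟩ G y x)   ≡⟨ cong₂ _-_ (Δf x) (sym Δ𝟙≡) ⟩
    Δ G f x - Δ G 𝟙ᵀ x                                  ≡⟨ cong (_- Δ G 𝟙ᵀ x) (Δ-cong f≗ x) ⟩
    Δ G (λ z → lowered z + 𝟙ᵀ z) x - Δ G 𝟙ᵀ x           ≡⟨ cong (_- Δ G 𝟙ᵀ x) (Δ-+ lowered 𝟙ᵀ x) ⟩
    (Δ G lowered x + Δ G 𝟙ᵀ x) - Δ G 𝟙ᵀ x               ≡⟨ m+n-n≡m _ _ ⟩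
    Δ G lowered x                                       ∎
    where
    open ≡-Reasoning
    𝟙ᵀ : V G → ℤ
    𝟙ᵀ = 𝟙 top?
    Δ𝟙≡ : Δ G 𝟙ᵀ x ≡ ⟨_⟩ G u x - ⟨_⟩ G y x
    Δ𝟙≡ = Δ-𝟙 top? leaving only x
    f≗ : ∀ z → f z ≡ lowered z + 𝟙ᵀ z
    f≗ z = sym (m-n+n≡m (f z) (𝟙ᵀ z))

  lowered≤top-1 : ∀ x → lowered x ≤ f top - 1ℤ
  lowered≤top-1 x with top? x
  ... | yes x-top = ≤-reflexive (cong (_- 1ℤ) x-top)
  ... | no ¬x-top = begin
    f x - 0ℤ      ≡⟨ +-identityʳ (f x) ⟩
    f x           ≤⟨ i<j⇒i≤pred[j] (≤∧≢⇒< (top-max x) ¬x-top) ⟩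
    ℤ.pred (f top) ≡⟨ +-comm -1ℤ (f top) ⟩
    f top - 1ℤ    ∎
    where open ≤-Reasoning

  spread-lowered : ∀ {k} → Spread f (suc k) → Spread lowered k
  spread-lowered {k} spread x y =
    ≤-trans (+-monoˡ-≤ (- lowered y) (lowered≤top-1 x)) (top-1-lowered y)
    where
    top-1-lowered : ∀ y → (f top - 1ℤ) - lowered y ≤ + k
    top-1-lowered y with top? y
    ... | yes y-top = begin
      (f top - 1ℤ) - (f y - 1ℤ)   ≡⟨ cong (λ t → (f top - 1ℤ) - (t - 1ℤ)) y-top ⟩
      (f top - 1ℤ) - (f top - 1ℤ) ≡⟨ +-inverseʳ (f top - 1ℤ) ⟩
      0ℤ                          ≤⟨ +≤+ z≤n ⟩
      + k                         ∎
      where open ≤-Reasoning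
    ... | no _ = begin
      (f top - 1ℤ) - (f y - 0ℤ)   ≡⟨ [m-1]-[n-0]≡[m-n]-1 (f top) (f y) ⟩
      (f top - f y) - 1ℤ          ≤⟨ +-monoˡ-≤ -1ℤ (spread top y) ⟩
      + suc k - 1ℤ                ≡⟨⟩
      + k                         ∎
      where open ≤-Reasoning

  vertex-below-top : u ≢ v → ∃ λ x → ¬ Top x
  vertex-below-top u≢v with Fin.any? (λ x → ¬? (top? x))
  ... | yes below = below
  ... | no ¬below = ⊥-elim (1≢0 (begin
    1ℤ                        ≡⟨ cong₂ _-_ (⟨⟩-self u) (⟨⟩-other u≢v) ⟨
    ⟨_⟩ G u u - ⟨_⟩ G v u     ≡⟨ Δf u ⟩
    Δ G f u                   ≡⟨ Δ-constant f (f top) all-top u ⟩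
    0ℤ                        ∎))
    where
    open ≡-Reasoning
    all-top : ∀ x → Top x
    all-top x = decidable-stable (top? x) (¬below ∘ (x ,_))
    1≢0 : 1ℤ ≢ 0ℤ
    1≢0 ()

  flat⇒u≡v : Spread f 0 → u ≡ v
  flat⇒u≡v spread with u ≟ v
  ... | yes u≡v = u≡v
  ... | no u≢v with vertex-below-top u≢v
  ...   | c , ¬c-top = ⊥-elim (¬c-top (≤-antisym (top-max c) (i-j≤0⇒i≤j (spread top c))))

  exit-at-u : Connected G → u ≢ v → ∃ λ y → ∃ λ e → Leaves Top e u y
  exit-at-u connected u≢v with vertex-below-top u≢v
  ... | c , ¬c-top with walk-exits top? (connected top c) refl ¬c-top
  ...   | e , _ , x , y , leaving with exit-from-u leaving
  ...     | refl = y , e , leaving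

module Backward (G : Multigraph) (connected : Connected G) where
  open Walks G using (Leaves)
  open Cuts G

  spread⇒sameImage : ∀ k f {u v} → Spread f k → (∀ x → ⟨_⟩ G u x - ⟨_⟩ G v x ≡ Δ G f x) →
                     SameImage G u v
  spread⇒sameImage k f {u} {v} spread Δf with u ≟ v
  ... | yes refl = [] , []
  ... | no u≢v   = descend k spread
    where
    open MaximumLevelSet G f Δf
    descend : ∀ j → Spread f j → SameImage G u v
    descend zero    flat   = ⊥-elim (u≢v (flat⇒u≡v flat))
    descend (suc j) bound = cross (exit-at-u connected u≢v)
      where
      cross : (∃ λ y → ∃ λ e → Leaves Top e u y) → SameImage G u v
      cross (y , e , leaving@(uy , _)) =
        let w , acyclic = spread⇒sameImage j lowered (spread-lowered bound) (Δ-lowered leaving only)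
        in  step e uy w , onlyExit⇒notInCycle top? leaving only ∷ acyclic
        where
        only : OnlyExit Top e
        only = exit-unique leaving

  ∼⇒sameImage : ∀ {u v} → _∼_ G (⟨_⟩ G u) (⟨_⟩ G v) → SameImage G u v
  ∼⇒sameImage (f , Δf) with spread-finite f
  ... | k , spread = spread⇒sameImage k f spread Δf

lemma4p6 : (G : Multigraph) → Connected G →
           (v₁ v₂ : V G) → SameImage G v₁ v₂ ⇔ _∼_ G (⟨_⟩ G v₁) (⟨_⟩ G v₂)
lemma4p6 G connected v₁ v₂ = mk⇔ (Cuts.sameImage⇒∼ G) (Backward.∼⇒sameImage G connected)
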